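{- Let $s\geqslant1$. (1) The Markov Rule does not hold in $\mathcal B_s$: there is a formula $\varphi(x)$ of the language of $LP_s$ (with its other free variables evaluated by elements of the model's domains) such that $\mathcal B_s\Vdash\forall x[\varphi(x)\vee\neg\varphi(x)]$ and $\mathcal B_s\Vdash\neg\neg\exists x\varphi(x)$, but not $\mathcal B_s\Vdash\exists x\varphi(x)$. (2) The Markov Principle $\forall x[\varphi(x)\vee\neg\varphi(x)]\wedge\neg\neg\exists x\varphi(x)\supset\exists x\varphi(x)$ does not hold in $\mathcal B_s$, i.e. some instance of it is not forced in $\mathcal B_s$.
   Context: Language. $L$ is a many-sorted language with variables $x,y,z,\dots$ of type 0 and, for $n\geqslant1$, $F^n,\dots$ over $n$-functionals, $A^n,\dots$ over lawlike and $\mathcal F^n,\dots$ over lawless $n$-functionals; constants $0,K^n$; function symbols $S,+,\cdot,N^n,Ap^n$; type-0 variables and $0$ are terms, type-$n$ variables and $K^n$ are $n$-functionals, $St,t_1+t_2,t_1\cdot t_2$ terms, $N^n(Z)$ $n$-functionals, $Ap^1(Z,t)=Z(t)$ a term for a $1$-functional $Z$, $Ap^{n+1}(Z,t)=Z(t)$ an $n$-functional. Atomic formulas $t=_0\tau$, $Z=_nV$; formulas use $\bot,\wedge,\vee,\supset,\forall,\exists$, $\neg\varphi:=\varphi\supset\bot$. $LP$ adds atomic formulas $\vdash_z\varphi(\bar X)$ for formulas $\varphi$ of $L$ with free variables among $\bar X$; $LP_s$: types $\leqslant s$. The Beth model $\mathcal B_s$ ($s\geqslant1$). A path is a maximal linearly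 ordered subset. $a_0=\omega$; $d_0=\{\langle x\rangle: x$ a finite sequence of naturals$\}$, $\langle x\rangle\preccurlyeq_0\langle y\rangle$ iff $y$ is an initial segment of $x$. For $k\geqslant1$, $a_k$: partial functions $f:d_{k-1}\times\omega\dashrightarrow a_{k-1}$, monotonic (if $y\preccurlyeq_{k-1}x$ and $f(x,n)$ defined then $f(y,n)=f(x,n)$) and complete (for every path $S$ of $d_{k-1}$ and $n$, some $x\in S$ has $f(x,n)$ defined); $d_k=\bigcup_m(a_0^{(m)}\times\dots\times a_k^{(m)})$; $x\preccurlyeq_ky$ iff each component of $y$ is an initial segment of the corresponding one of $x$; $lh(x)=m$. Nodes $M=d_{s-1}$, $\preccurlyeq=\preccurlyeq_{s-1}$, root $\varepsilon$; $\bar\alpha(k)$ = first $k$ components of $\alpha$. Domains: $\omega$; $a_k$; $b_k=\{f\in a_k:f(r,n)$ defined for all $n$, $r$ root of $d_{k-1}\}$ (lawlike); $l_k=\{\nu_k(\xi)\}$ (lawless), $\xi:\omega\times a_{k-1}\to a_{k-1}$ with each $\xi(n,\cdot)$ bijective, $\nu_k(\xi)(x,n)=\xi(n,\text{$n$-th entry of last component of $x$})$ for $n<lh(x)$, undefined otherwise. Interpretation: $\hat K^1(x,n)=0$, $\hat K^{k+1}(x,n)=\hat K^k$; $S,+,\cdot$ standard; $N^k\mapsto S^k$ ($S^0(x)=x+1$, $S^{k+1}(f)(x,n)=S^k(f(x,n))$); at $\alpha$: $Ap^k(f,n)\mapsto f(\bar\alpha(k),n)$; $Z^{[\alpha]}$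 compositional value (possibly undefined). $Val(\alpha,Z=_kV)=T$ iff both defined and equal; $Val(\alpha,\vdash_t\varphi)=T$ iff $t^{[\alpha]}$ defined and some $\gamma\succcurlyeq\alpha$ with $lh(\gamma)=t^{[\alpha]}$ forces $\varphi$. Beth forcing: atomic: every path through $\alpha$ meets $\beta$ with $Val(\beta,\varphi)=T$; $\bot$ never; $\wedge$ componentwise; $\vee$, $\exists$: every path through $\alpha$ meets $\beta$ forcing a disjunct / an instance $\psi(c)$, $c$ in the domain; $\supset$: every $\beta\preccurlyeq\alpha$ forcing the antecedent forces the consequent; $\forall$: all domain elements. $\mathcal B_s\Vdash\varphi$ iff $\varepsilon\Vdash\varphi$. -}

module Defs where

-- Formalisation of the Beth model B_s for the language LP_s.
-- Everything lives in Set (subsets / paths are represented by characteristic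
-- functions into Bool).

open import Data.Nat using (ℕ; zero; suc; _+_; _*_; _∸_; _≤_; _<_; _<ᵇ_; pred)
open import Data.Nat.Properties using (m∸n+n≡m; ≤-pred)
open import Data.Bool using (Bool; true; false; if_then_else_)
open import Data.Maybe using (Maybe; just; nothing; map; _>>=_)
open import Data.Vec using (Vec; []; _∷_; lookup)
open import Data.Fin using (Fin; fromℕ<)
open import Data.Product using (Σ; _×_; _,_; proj₁; proj₂)
open import Data.Sum using (_⊎_)
open import Data.Unit using (⊤; tt)
open import Data.Empty using (⊥)
open import Data.List using (List; []; _∷_)
open import Relation.Binary.PropositionalEquality using (_≡_; subst; sym)
open import Relation.Nullary using (¬_)

MRel : {X : Set} → (X → X → Set) → Maybe X → Maybe X → Set
MRel R nothing  nothing  = ⊤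
MRel R (just a) (just b) = R a b
MRel R _        _        = ⊥

Defined : {X : Set} → Maybe X → Set
Defined {X} m = Σ X (λ v → m ≡ just v)

Pref : {X : Set} → (X → X → Set) → ∀ {m n} → Vec X m → Vec X n → Set
Pref R []       _        = ⊤
Pref R (y ∷ ys) []       = ⊥
Pref R (y ∷ ys) (x ∷ xs) = R y x × Pref R ys xs

-- Rw k      : raw (possibly non-valid) objects of type k
--             (Rw 0 = ℕ, Rw (k+1) = partial functions d_k × ω ⇀ Rw k)
--   Valid k   : membership in a_k (monotonic, complete, values in a_{k-1})
--   A k       : a_k
--   RE k      : (extensional) equality of objects of type k
--   D k       : d_k = ⋃_m (a_0^(m) × … × a_k^(m))
--   x ≼ y     : each component of y is an initial segment of that of x

mutual
  Rw : ℕ → Set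
  Rw zero    = ℕ
  Rw (suc k) = D k → ℕ → Maybe (Rw k)

  RE : (k : ℕ) → Rw k → Rw k → Set
  RE zero    a b = a ≡ b
  RE (suc k) f g = ∀ (x : D k) (n : ℕ) → MRel (RE k) (f x n) (g x n)

  Valid : (k : ℕ) → Rw k → Set
  Valid zero    _ = ⊤
  Valid (suc k) f =
    Mono k f × Complete k f × (∀ x n v → f x n ≡ just v → Valid k v)

  A : ℕ → Set
  A k = Σ (Rw k) (Valid k)

  EqA : (k : ℕ) → A k → A k → Set
  EqA k a b = RE k (proj₁ a) (proj₁ b)

  Comps : ℕ → ℕ → Set
  Comps zero    m = Vec (A zero) m
  Comps (suc k) m = Comps k m × Vec (A (suc k)) m

  D : ℕ → Set
  D k = Σ ℕ (Comps k)

  CPref : (k : ℕ) → ∀ {m n} → Comps k m → Comps k n → Set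
  CPref zero    ys        xs        = Pref (EqA zero) ys xs
  CPref (suc k) (ys , y) (xs , x) = CPref k ys xs × Pref (EqA (suc k)) y x

  -- x ≼ y  iff  y is an initial segment of x (x lies above/extends y)
  Le : (k : ℕ) → D k → D k → Set
  Le k x y = CPref k (proj₂ y) (proj₂ x)

  Chain : (k : ℕ) → (D k → Bool) → Set
  Chain k P = ∀ x y → P x ≡ true → P y ≡ true → Le k x y ⊎ Le k y x

  IsPath : (k : ℕ) → (D k → Bool) → Set
  IsPath k P = Chain k P ×
    (∀ (Q : D k → Bool) → Chain k Q → (∀ x → P x ≡ true → Q x ≡ true) →
       ∀ x → Q x ≡ true → P x ≡ true)

  Mono : (k : ℕ) → Rw (suc k) → Set
  Mono k f = ∀ x y n v → Le k y x → f x n ≡ just v →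
    Σ (Rw k) (λ w → (f y n ≡ just w) × RE k w v)

  Complete : (k : ℕ) → Rw (suc k) → Set
  Complete k f = ∀ (P : D k → Bool) → IsPath k P → ∀ n →
    Σ (D k) (λ x → (P x ≡ true) × Defined (f x n))

lh : ∀ {k} → D k → ℕ
lh = proj₁

emptyComps : (k : ℕ) → Comps k 0
emptyComps zero    = []
emptyComps (suc k) = emptyComps k , []

root : (k : ℕ) → D k
root k = 0 , emptyComps k

lastComp : (k : ℕ) → ∀ {m} → Comps k m → Vec (A k) m
lastComp zero    c       = c
lastComp (suc k) (_ , v) = v

Lawlike : (k : ℕ) → A (suc k) → Set
Lawlike k f = ∀ n → Defined (proj₁ f (root k) n)

BijFam : (k : ℕ) → (ℕ → A k → A k) → Set
BijFam k ξ = ∀ n →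
  (∀ a b → EqA k a b → EqA k (ξ n a) (ξ n b)) ×
  (∀ a b → EqA k (ξ n a) (ξ n b) → EqA k a b) ×
  (∀ b → Σ (A k) (λ a → EqA k (ξ n a) b))

nu : (k : ℕ) → (ℕ → A k → A k) → Rw (suc k)
nu k ξ (m , c) n with n <ᵇ m | Data.Nat.Properties.<ᵇ⇒< n m
... | true  | p = just (proj₁ (ξ n (lookup (lastComp k c) (fromℕ< (p _)))))
... | false | _ = nothing

Lawless : (k : ℕ) → A (suc k) → Set
Lawless k f = Σ (ℕ → A k → A k) (λ ξ → BijFam k ξ × RE (suc k) (proj₁ f) (nu k ξ))

Khat : (k : ℕ) → Rw k
Khat zero    = 0
Khat (suc k) = λ _ _ → just (Khat k)

Shat : (k : ℕ) → Rw k → Rw k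
Shat zero    x = suc x
Shat (suc k) f = λ x n → map (Shat k) (f x n)

-- truncation ᾱ(k+1): the first k+1 components of α ∈ d_t, for k ≤ t

ctrD : (d k : ℕ) → ∀ {m} → Comps (d + k) m → Comps k m
ctrD zero    k c       = c
ctrD (suc d) k (c , _) = ctrD d k c

trunc : ∀ {k t} → k ≤ t → D t → D k
trunc {k} {t} p (m , c) =
  m , ctrD (t ∸ k) k (subst (λ j → Comps j m) (sym (m∸n+n≡m p)) c)

-- sorts of variables: type 0, and for k < s the (k+1)-functionals:
-- general, lawlike, lawless
data Sort (s : ℕ) : Set where
  num     : Sort s
  gen     : (k : ℕ) → k < s → Sort s
  lawlike : (k : ℕ) → k < s → Sort s
  lawless : (k : ℕ) → k < s → Sort s

ty : ∀ {s} → Sort s → ℕ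
ty num             = 0
ty (gen k _)       = suc k
ty (lawlike k _)   = suc k
ty (lawless k _)   = suc k

Ctx : ℕ → Set
Ctx s = List (Sort s)

data _∋_ {s : ℕ} : Ctx s → Sort s → Set where
  here  : ∀ {Γ σ} → (σ ∷ Γ) ∋ σ
  there : ∀ {Γ σ τ} → Γ ∋ σ → (τ ∷ Γ) ∋ σ

data Tm (s : ℕ) (Γ : Ctx s) : ℕ → Set where
  var  : ∀ {σ} → Γ ∋ σ → Tm s Γ (ty σ)
  zer  : Tm s Γ 0
  S    : Tm s Γ 0 → Tm s Γ 0
  plus : Tm s Γ 0 → Tm s Γ 0 → Tm s Γ 0
  mult : Tm s Γ 0 → Tm s Γ 0 → Tm s Γ 0
  K    : (k : ℕ) → k < s → Tm s Γ (suc k)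
  N    : ∀ {k} → Tm s Γ (suc k) → Tm s Γ (suc k)
  Ap   : ∀ {k} → k < s → Tm s Γ (suc k) → Tm s Γ 0 → Tm s Γ k

-- Fm s false Γ : formulas of L (types ≤ s);  Fm s true Γ : formulas of LP_s
data Fm (s : ℕ) : Bool → Ctx s → Set where
  bot  : ∀ {b Γ} → Fm s b Γ
  eq0  : ∀ {b Γ} → Tm s Γ 0 → Tm s Γ 0 → Fm s b Γ
  eqF  : ∀ {b Γ} (k : ℕ) → k < s → Tm s Γ (suc k) → Tm s Γ (suc k) → Fm s b Γ
  prov : ∀ {Γ} → Tm s Γ 0 → Fm s false Γ → Fm s true Γ
  and  : ∀ {b Γ} → Fm s b Γ → Fm s b Γ → Fm s b Γ
  or   : ∀ {b Γ} → Fm s b Γ → Fm s b Γ → Fm s b Γ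
  imp  : ∀ {b Γ} → Fm s b Γ → Fm s b Γ → Fm s b Γ
  all  : ∀ {b Γ} (σ : Sort s) → Fm s b (σ ∷ Γ) → Fm s b Γ
  ex   : ∀ {b Γ} (σ : Sort s) → Fm s b (σ ∷ Γ) → Fm s b Γ

neg : ∀ {s b Γ} → Fm s b Γ → Fm s b Γ
neg φ = imp φ bot

Dom : ∀ {s} → Sort s → Set
Dom num             = ℕ
Dom (gen k _)       = A (suc k)
Dom (lawlike k _)   = Σ (A (suc k)) (Lawlike k)
Dom (lawless k _)   = Σ (A (suc k)) (Lawless k)

rawOf : ∀ {s} (σ : Sort s) → Dom σ → Rw (ty σ)
rawOf num           n = n
rawOf (gen k _)     f = proj₁ f
rawOf (lawlike k _) f = proj₁ (proj₁ f)
rawOf (lawless k _) f = proj₁ (proj₁ f)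

data Env (s : ℕ) : Ctx s → Set where
  []ₑ  : Env s []
  _∷ₑ_ : ∀ {σ Γ} → Dom σ → Env s Γ → Env s (σ ∷ Γ)

lookupEnv : ∀ {s Γ σ} → Env s Γ → Γ ∋ σ → Rw (ty σ)
lookupEnv {σ = σ} (d ∷ₑ _) here      = rawOf σ d
lookupEnv         (_ ∷ₑ ρ) (there i) = lookupEnv ρ i

Node : ℕ → Set
Node s = D (pred s)

k<s⇒k≤pred : ∀ {k s} → k < s → k ≤ pred s
k<s⇒k≤pred {s = suc s} p = ≤-pred p

eval : ∀ {s Γ k} → Node s → Env s Γ → Tm s Γ k → Maybe (Rw k)
eval α ρ (var i)      = just (lookupEnv ρ i)
eval α ρ zer          = just 0
eval α ρ (S t)        = map suc (eval α ρ t)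
eval α ρ (plus t u)   = eval α ρ t >>= λ a → map (a +_) (eval α ρ u)
eval α ρ (mult t u)   = eval α ρ t >>= λ a → map (a *_) (eval α ρ u)
eval α ρ (K k _)      = just (Khat (suc k))
eval α ρ (N {k} Z)    = map (Shat (suc k)) (eval α ρ Z)
eval α ρ (Ap p Z t)   =
  eval α ρ Z >>= λ f → eval α ρ t >>= λ n → f (trunc (k<s⇒k≤pred p) α) n

ValEq : {X : Set} → (X → X → Set) → Maybe X → Maybe X → Set
ValEq R (just a) (just b) = R a b
ValEq R _        _        = ⊥

PathThrough : (s : ℕ) → Node s → (Node s → Bool) → Set
PathThrough s α P = IsPath (pred s) P × (P α ≡ true)

Bar : (s : ℕ) → Node s → (Node s → Set) → Set
Bar s α C = ∀ P → PathThrough s α P → Σ (Node s) (λ β → (P β ≡ true) × C β)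

Forces : ∀ s {b Γ} → Node s → Env s Γ → Fm s b Γ → Set
Forces s α ρ bot          = ⊥
Forces s α ρ (eq0 t u)    = Bar s α (λ β → ValEq _≡_ (eval β ρ t) (eval β ρ u))
Forces s α ρ (eqF k _ Z V) =
  Bar s α (λ β → ValEq (RE (suc k)) (eval β ρ Z) (eval β ρ V))
Forces s α ρ (prov t φ)   = Bar s α (λ β →
  Σ ℕ (λ m → (eval β ρ t ≡ just m) ×
    Σ (Node s) (λ γ → Le (pred s) β γ × (lh γ ≡ m) × Forces s γ ρ φ)))
Forces s α ρ (and φ ψ)    = Forces s α ρ φ × Forces s α ρ ψ
Forces s α ρ (or φ ψ)     = Bar s α (λ β → Forces s β ρ φ ⊎ Forces s β ρ ψ)
Forces s α ρ (imp φ ψ)    =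
  ∀ β → Le (pred s) β α → Forces s β ρ φ → Forces s β ρ ψ
Forces s α ρ (all σ φ)    = ∀ (c : Dom σ) → Forces s α (c ∷ₑ ρ) φ
Forces s α ρ (ex σ φ)     =
  Bar s α (λ β → Σ (Dom σ) (λ c → Forces s β (c ∷ₑ ρ) φ))

BForces : ∀ s {b Γ} → Env s Γ → Fm s b Γ → Set
BForces s ρ φ = Forces s (root (pred s)) ρ φ

MarkovInstance : ∀ {s Γ} → Fm s true (num ∷ Γ) → Fm s true Γ
MarkovInstance φ =
  imp (and (all num (or φ (neg φ))) (neg (neg (ex num φ)))) (ex num φ)

-- Let F(α, n) be the n-th natural number in the first component of the node α, and φ(x) :≡ F(x) = 1.
-- With excluded middle every path is unbounded (a path with a longest node could be extended by
-- one more node), so F is complete, and on every path F(x) eventually gets a value, deciding φ(x).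
-- Any node can be extended by a 1, so ∃x φ(x) is never refuted. But on the path of nodes whose
-- entries are all 0, F never takes the value 1, so ∃x φ(x) is not forced at the root, and hence
-- neither is the Markov instance, whose antecedent is.

module Submission where

open import Defs
open import Level using (0ℓ)
open import Axiom.ExcludedMiddle using (ExcludedMiddle)
open import Data.Nat using (ℕ; zero; suc; _+_; _<_; _≤_; _≤′_; _≡ᵇ_; _≟_; z≤n; s≤s; ≤′-refl; ≤′-step)
open import Data.Nat.Properties using (m∸n+n≡m; m≤m+n; ≤-refl; ≤-trans; ≤-total; ≤⇒≤′; ≮⇒≥)
open import Data.Bool using (Bool; true; false; _∨_)
open import Data.Maybe using (Maybe; just; nothing)
open import Data.Vec using (Vec; []; _∷_; _∷ʳ_)
open import Data.List using ([]; _∷_)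
open import Data.Product using (Σ; _×_; _,_; proj₁; proj₂)
open import Data.Sum using (_⊎_; inj₁; inj₂; swap)
open import Data.Unit using (tt)
open import Relation.Nullary using (¬_; does; yes; no)
open import Relation.Nullary.Decidable using (dec-true; decidable-stable)
open import Relation.Binary.Structures using (IsEquivalence)
open import Relation.Binary.PropositionalEquality
  using (_≡_; _≗_; refl; sym; trans; cong; subst)
import Relation.Binary.PropositionalEquality.Properties as ≡
import Relation.Binary.Construct.On as On

MRel-isEquivalence : ∀ {X} {R : X → X → Set} → IsEquivalence R → IsEquivalence (MRel R)
MRel-isEquivalence {R = R} eq = record
  { refl = λ {m} → refl′ m ; sym = λ {m n} → sym′ m n ; trans = λ {m n o} → trans′ m n o }
  where
  module R = IsEquivalence eq
  refl′ : ∀ m → MRel R m m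
  refl′ nothing  = tt
  refl′ (just a) = R.refl
  sym′ : ∀ m n → MRel R m n → MRel R n m
  sym′ nothing  nothing  _ = tt
  sym′ (just a) (just b) p = R.sym p
  trans′ : ∀ m n o → MRel R m n → MRel R n o → MRel R m o
  trans′ nothing  nothing  nothing  _ _ = tt
  trans′ (just a) (just b) (just c) p q = R.trans p q

RE-isEquivalence : ∀ k → IsEquivalence (RE k)
RE-isEquivalence zero    = ≡.isEquivalence
RE-isEquivalence (suc k) = record
  { refl  = λ {f} x n → M.refl {f x n}
  ; sym   = λ {f g} p x n → M.sym {f x n} {g x n} (p x n)
  ; trans = λ {f g h} p q x n → M.trans {f x n} {g x n} {h x n} (p x n) (q x n)
  }
  where module M = IsEquivalence (MRel-isEquivalence (RE-isEquivalence k))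

EqA-isEquivalence : ∀ k → IsEquivalence (EqA k)
EqA-isEquivalence k = On.isEquivalence proj₁ (RE-isEquivalence k)

module _ {X : Set} {R : X → X → Set} (eq : IsEquivalence R) where
  private module R = IsEquivalence eq

  Pref-refl : ∀ {m} (u : Vec X m) → Pref R u u
  Pref-refl []      = tt
  Pref-refl (a ∷ u) = R.refl , Pref-refl u

  Pref-∷ʳ : ∀ {m} (u : Vec X m) a → Pref R u (u ∷ʳ a)
  Pref-∷ʳ []      _ = tt
  Pref-∷ʳ (b ∷ u) a = R.refl , Pref-∷ʳ u a

  Pref-trans : ∀ {l m n} (u : Vec X l) (v : Vec X m) (w : Vec X n) →
    Pref R u v → Pref R v w → Pref R u w
  Pref-trans []      _       _       _       _       = tt
  Pref-trans (a ∷ u) (b ∷ v) (c ∷ w) (p , p′) (q , q′) = R.trans p q , Pref-trans u v w p′ q′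

  Pref-flip : ∀ {m n} (u : Vec X m) (v : Vec X n) → Pref R u v → n ≤ m → Pref R v u
  Pref-flip _       []      _        _        = tt
  Pref-flip (a ∷ u) (b ∷ v) (p , p′) (s≤s n≤m) = R.sym p , Pref-flip u v p′ n≤m

  Pref-common-extension : ∀ {l m n} (u : Vec X l) (v : Vec X m) (w : Vec X n) →
    Pref R u w → Pref R v w → l ≤ m → Pref R u v
  Pref-common-extension []      _       _       _        _        _        = tt
  Pref-common-extension (a ∷ u) (b ∷ v) (c ∷ w) (p , p′) (q , q′) (s≤s l≤m) =
    R.trans p (R.sym q) , Pref-common-extension u v w p′ q′ l≤m

CPref-refl : ∀ k {m} (c : Comps k m) → CPref k c c
CPref-refl zero    c       = Pref-refl (EqA-isEquivalence zero) c
CPref-refl (suc k) (c , u) = CPref-refl k c , Pref-refl (EqA-isEquivalence (suc k)) u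

CPref-trans : ∀ k {l m n} (c : Comps k l) (d : Comps k m) (e : Comps k n) →
  CPref k c d → CPref k d e → CPref k c e
CPref-trans zero    c       d       e       p        q        = Pref-trans (EqA-isEquivalence zero) c d e p q
CPref-trans (suc k) (c , u) (d , v) (e , w) (p , p′) (q , q′) =
  CPref-trans k c d e p q , Pref-trans (EqA-isEquivalence (suc k)) u v w p′ q′

CPref-flip : ∀ k {m n} (c : Comps k m) (d : Comps k n) → CPref k c d → n ≤ m → CPref k d c
CPref-flip zero    c       d       p        n≤m = Pref-flip (EqA-isEquivalence zero) c d p n≤m
CPref-flip (suc k) (c , u) (d , v) (p , p′) n≤m =
  CPref-flip k c d p n≤m , Pref-flip (EqA-isEquivalence (suc k)) u v p′ n≤m

CPref-common-extension : ∀ k {l m n} (c : Comps k l) (d : Comps k m) (e : Comps k n) →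
  CPref k c e → CPref k d e → l ≤ m → CPref k c d
CPref-common-extension zero    c       d       e       p        q        l≤m =
  Pref-common-extension (EqA-isEquivalence zero) c d e p q l≤m
CPref-common-extension (suc k) (c , u) (d , v) (e , w) (p , p′) (q , q′) l≤m =
  CPref-common-extension k c d e p q l≤m ,
  Pref-common-extension (EqA-isEquivalence (suc k)) u v w p′ q′ l≤m

CPref-empty : ∀ k {n} (c : Comps k 0) (d : Comps k n) → CPref k c d
CPref-empty zero    []       _       = tt
CPref-empty (suc k) (c , []) (d , _) = CPref-empty k c d , tt

Le-refl : ∀ k (x : D k) → Le k x x
Le-refl k x = CPref-refl k (proj₂ x)

Le-trans : ∀ k (x y z : D k) → Le k x y → Le k y z → Le k x z
Le-trans k x y z x≼y y≼z = CPref-trans k (proj₂ z) (proj₂ y) (proj₂ x) y≼z x≼y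

Le-flip : ∀ k (x y : D k) → Le k x y → lh x ≤ lh y → Le k y x
Le-flip k x y x≼y = CPref-flip k (proj₂ y) (proj₂ x) x≼y

Le-common-extension : ∀ k (x y z : D k) → Le k z x → Le k z y → lh x ≤ lh y → Le k y x
Le-common-extension k x y z = CPref-common-extension k (proj₂ x) (proj₂ y) (proj₂ z)

Le-empty : ∀ k (x y : D k) → (lh x ≡ᵇ 0) ≡ true → Le k y x
Le-empty k (zero , c) y _ = CPref-empty k c (proj₂ y)

Comparable : ∀ k → D k → D k → Set
Comparable k x y = Le k x y ⊎ Le k y x

path-absorbs : ∀ k {P} → IsPath k P → (B : D k → Bool) → Chain k B →
  (∀ x y → B x ≡ true → P y ≡ true → Comparable k x y) →
  ∀ x → B x ≡ true → P x ≡ true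
path-absorbs k {P} (chainP , maximal) B chainB B~P x Bx =
  maximal (λ z → B z ∨ P z) chain∨ P⊆B∨P x (cong (_∨ P x) Bx)
  where
  ∨-true : ∀ a b → a ∨ b ≡ true → a ≡ true ⊎ b ≡ true
  ∨-true true  _ _ = inj₁ refl
  ∨-true false _ h = inj₂ h

  P⊆B∨P : ∀ z → P z ≡ true → B z ∨ P z ≡ true
  P⊆B∨P z Pz with B z
  ... | true  = refl
  ... | false = Pz

  chain∨ : Chain k (λ z → B z ∨ P z)
  chain∨ y z hy hz with ∨-true (B y) (P y) hy | ∨-true (B z) (P z) hz
  ... | inj₁ By | inj₁ Bz = chainB y z By Bz
  ... | inj₁ By | inj₂ Pz = B~P y z By Pz
  ... | inj₂ Py | inj₁ Bz = swap (B~P z y Bz Py)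
  ... | inj₂ Py | inj₂ Pz = chainP y z Py Pz

root-on-path : ∀ k {P} → IsPath k P → P (root k) ≡ true
root-on-path k path = path-absorbs k path (λ x → lh x ≡ᵇ 0)
  (λ x y _ y₀ → inj₁ (Le-empty k y x y₀))
  (λ x y x₀ _ → inj₂ (Le-empty k x y x₀))
  (root k) refl

K-valid : ∀ k → Valid k (Khat k)
K-valid zero    = tt
K-valid (suc k) = monotonic , complete , λ { _ _ _ refl → K-valid k }
  where
  monotonic : Mono k (Khat (suc k))
  monotonic _ _ _ _ _ refl = Khat k , refl , IsEquivalence.refl (RE-isEquivalence k)

  complete : Complete k (Khat (suc k))
  complete P path _ = root k , root-on-path k path , Khat k , refl

Kel : ∀ k → A k
Kel k = Khat k , K-valid k

extendComps : ∀ k {m} → ℕ → Comps k m → Comps k (suc m)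
extendComps zero    a c       = c ∷ʳ (a , tt)
extendComps (suc k) a (c , u) = extendComps k a c , u ∷ʳ Kel (suc k)

extend : ∀ k → ℕ → D k → D k
extend k a (m , c) = suc m , extendComps k a c

Le-extend : ∀ k a (x : D k) → Le k (extend k a x) x
Le-extend k a (m , c) = go k c
  where
  go : ∀ k {m} (c : Comps k m) → CPref k c (extendComps k a c)
  go zero    c       = Pref-∷ʳ (EqA-isEquivalence zero) c (a , tt)
  go (suc k) (c , u) = go k c , Pref-∷ʳ (EqA-isEquivalence (suc k)) u (Kel (suc k))

pad : ∀ k → ℕ → D k → D k
pad k zero    x = x
pad k (suc n) x = extend k 0 (pad k n x)

lh-pad : ∀ k n (x : D k) → lh (pad k n x) ≡ n + lh x
lh-pad k zero    x = refl
lh-pad k (suc n) x = cong suc (lh-pad k n x)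

Le-pad : ∀ k (x : D k) {m n} → m ≤ n → Le k (pad k n x) (pad k m x)
Le-pad k x m≤n = go (≤⇒≤′ m≤n)
  where
  go : ∀ {m n} → m ≤′ n → Le k (pad k n x) (pad k m x)
  go ≤′-refl            = Le-refl k _
  go (≤′-step {n} m≤′n) = Le-trans k _ _ _ (Le-extend k 0 (pad k n x)) (go m≤′n)

entry : ∀ {m} → Vec (A 0) m → ℕ → Maybe ℕ
entry []      _       = nothing
entry (a ∷ u) zero    = just (proj₁ a)
entry (a ∷ u) (suc n) = entry u n

entry-Pref : ∀ {l m} (u : Vec (A 0) l) (v : Vec (A 0) m) n {w} →
  Pref (EqA 0) u v → entry u n ≡ just w → entry v n ≡ just w
entry-Pref (a ∷ u) (b ∷ v) zero    (a≡b , _) e = trans (cong just (sym a≡b)) e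
entry-Pref (a ∷ u) (b ∷ v) (suc n) (_ , u≼v) e = entry-Pref u v n u≼v e

entry-defined : ∀ {m} (u : Vec (A 0) m) n → n < m → Defined (entry u n)
entry-defined (a ∷ u) zero    _         = proj₁ a , refl
entry-defined (a ∷ u) (suc n) (s≤s n<m) = entry-defined u n n<m

entry-∷ʳ-last : ∀ {m} (u : Vec (A 0) m) a → entry (u ∷ʳ a) m ≡ just (proj₁ a)
entry-∷ʳ-last []      a = refl
entry-∷ʳ-last (b ∷ u) a = entry-∷ʳ-last u a

entry-∷ʳ : ∀ {m} (u : Vec (A 0) m) a n {w} →
  entry (u ∷ʳ a) n ≡ just w → entry u n ≡ just w ⊎ proj₁ a ≡ w
entry-∷ʳ []      a zero    refl = inj₂ refl
entry-∷ʳ (b ∷ u) a zero    e    = inj₁ e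
entry-∷ʳ (b ∷ u) a (suc n) e    = entry-∷ʳ u a n e

firstComp : ∀ k {m} → Comps k m → Vec (A 0) m
firstComp zero    c       = c
firstComp (suc k) (c , _) = firstComp k c

firstComp-CPref : ∀ k {m n} (c : Comps k m) (d : Comps k n) →
  CPref k c d → Pref (EqA 0) (firstComp k c) (firstComp k d)
firstComp-CPref zero    c       d       c≼d       = c≼d
firstComp-CPref (suc k) (c , _) (d , _) (c≼d , _) = firstComp-CPref k c d c≼d

firstComp-extend : ∀ k {m} a (c : Comps k m) →
  firstComp k (extendComps k a c) ≡ firstComp k c ∷ʳ (a , tt)
firstComp-extend zero    a c       = refl
firstComp-extend (suc k) a (c , _) = firstComp-extend k a c

firstComp-ctrD : ∀ d k {m} (c : Comps (d + k) m) → firstComp k (ctrD d k c) ≡ firstComp (d + k) c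
firstComp-ctrD zero    k c       = refl
firstComp-ctrD (suc d) k (c , _) = firstComp-ctrD d k c

firstComp-subst : ∀ {j j′ m} (e : j′ ≡ j) (c : Comps j′ m) →
  firstComp j (subst (λ i → Comps i m) e c) ≡ firstComp j′ c
firstComp-subst refl c = refl

firstEntry : ∀ k → D k → ℕ → Maybe ℕ
firstEntry k x = entry (firstComp k (proj₂ x))

firstEntry-mono : ∀ k (x y : D k) n {w} →
  Le k x y → firstEntry k y n ≡ just w → firstEntry k x n ≡ just w
firstEntry-mono k x y n x≼y = entry-Pref _ _ n (firstComp-CPref k (proj₂ y) (proj₂ x) x≼y)

firstEntry-defined : ∀ k (x : D k) n → n < lh x → Defined (firstEntry k x n)
firstEntry-defined k x = entry-defined (firstComp k (proj₂ x))

firstEntry-extend : ∀ k a (x : D k) → firstEntry k (extend k a x) (lh x) ≡ just a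
firstEntry-extend k a (m , c) rewrite firstComp-extend k a c = entry-∷ʳ-last (firstComp k c) (a , tt)

firstEntry-pad : ∀ k n (x : D k) c {w} →
  firstEntry k (pad k n x) c ≡ just w → firstEntry k x c ≡ just w ⊎ w ≡ 0
firstEntry-pad k zero    x c e = inj₁ e
firstEntry-pad k (suc n) x c e
  rewrite firstComp-extend k 0 (proj₂ (pad k n x))
  with entry-∷ʳ (firstComp k (proj₂ (pad k n x))) (0 , tt) c e
... | inj₁ e′ = firstEntry-pad k n x c e′
... | inj₂ 0≡w = inj₂ (sym 0≡w)

firstEntry-root : ∀ k c {w} → ¬ firstEntry k (root k) c ≡ just w
firstEntry-root k c = go (firstComp k (emptyComps k))
  where
  go : (u : Vec (A 0) 0) → ¬ entry u c ≡ just _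
  go [] ()

firstEntry-trunc : ∀ t (q : 0 ≤ t) (x : D t) → firstEntry 0 (trunc q x) ≗ firstEntry t x
firstEntry-trunc t q (m , c) n =
  cong (λ u → entry u n) (trans (firstComp-ctrD t 0 _) (firstComp-subst (sym (m∸n+n≡m q)) c))

entryFn : Rw 1
entryFn = firstEntry 0

module Classical (em : ExcludedMiddle 0ℓ) where

  holds : Set → Bool
  holds X = does (em {X})

  holds⇒ : ∀ {X} → holds X ≡ true → X
  holds⇒ {X} with em {X}
  ... | yes x = λ _ → x
  ... | no _  = λ ()

  ⇒holds : ∀ {X} → X → holds X ≡ true
  ⇒holds = dec-true em

  comparable⇒on-path : ∀ k {P} → IsPath k P → ∀ x →
    (∀ y → P y ≡ true → Comparable k x y) → P x ≡ true
  comparable⇒on-path k {P} path x x~P =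
    path-absorbs k path (λ z → holds (z ≡ x)) singleton singleton~P x (⇒holds refl)
    where
    singleton : Chain k (λ z → holds (z ≡ x))
    singleton y z hy hz with holds⇒ hy | holds⇒ hz
    ... | refl | refl = inj₁ (Le-refl k x)

    singleton~P : ∀ z y → holds (z ≡ x) ≡ true → P y ≡ true → Comparable k z y
    singleton~P z y hz Py with holds⇒ hz
    ... | refl = x~P y Py

  path-unbounded : ∀ k {P} → IsPath k P → ∀ x → P x ≡ true →
    Σ (D k) λ y → P y ≡ true × lh x < lh y
  path-unbounded k {P} path x Px = decidable-stable em λ none → none (x′ , x′-on-path none , ≤-refl)
    where
    x′ : D k
    x′ = extend k 0 x
    -- If P had no node longer than x, every node of P would be an initial segment of x,
    -- so P ∪ {x′} would be a chain.
    x′-on-path : ¬ (Σ (D k) λ y → P y ≡ true × lh x < lh y) → P x′ ≡ true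
    x′-on-path none = comparable⇒on-path k path x′ λ y Py →
      inj₁ (Le-trans k x′ x y (Le-extend k 0 x) (x≼ y Py))
      where
      x≼ : ∀ y → P y ≡ true → Le k x y
      x≼ y Py with proj₁ path x y Px Py
      ... | inj₁ x≼y = x≼y
      ... | inj₂ y≼x = Le-flip k y x y≼x (≮⇒≥ λ x<y → none (y , Py , x<y))

  path-long : ∀ k {P} → IsPath k P → ∀ n → Σ (D k) λ y → P y ≡ true × n < lh y
  path-long k path zero = path-unbounded k path (root k) (root-on-path k path)
  path-long k path (suc n) with path-long k path n
  ... | y , Py , n<y with path-unbounded k path y Py
  ... | z , Pz , y<z = z , Pz , ≤-trans (s≤s n<y) y<z

  -- The initial segments of x followed by zeros forever.
  ray : ∀ k → D k → D k → Bool
  ray k x y = holds (Le k (pad k (lh y) x) y)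

  on-ray : ∀ k {x y} → ray k x y ≡ true → Le k (pad k (lh y) x) y
  on-ray k = holds⇒

  ray-start : ∀ k x → ray k x x ≡ true
  ray-start k x = ⇒holds (Le-pad k x {0} {lh x} z≤n)

  ray-isPath : ∀ k x → IsPath k (ray k x)
  ray-isPath k x = chain , maximal
    where
    chain : Chain k (ray k x)
    chain y z hy hz with ≤-total (lh y) (lh z)
    ... | inj₁ y≤z = inj₂ (Le-common-extension k y z (pad k (lh z) x)
                       (Le-trans k _ _ y (Le-pad k x y≤z) (on-ray k hy)) (on-ray k hz) y≤z)
    ... | inj₂ z≤y = inj₁ (Le-common-extension k z y (pad k (lh y) x)
                       (Le-trans k _ _ z (Le-pad k x z≤y) (on-ray k hz)) (on-ray k hy) z≤y)

    maximal : ∀ Q → Chain k Q → (∀ y → ray k x y ≡ true → Q y ≡ true) →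
      ∀ y → Q y ≡ true → ray k x y ≡ true
    maximal Q chainQ ray⊆Q y Qy =
      ⇒holds (segment (chainQ y g Qy (ray⊆Q g (⇒holds (Le-pad k x y≤g)))))
      where
      g : D k
      g = pad k (lh y) x
      y≤g : lh y ≤ lh g
      y≤g = subst (lh y ≤_) (sym (lh-pad k (lh y) x)) (m≤m+n (lh y) (lh x))
      segment : Comparable k y g → Le k g y
      segment (inj₁ y≼g) = Le-flip k y g y≼g y≤g
      segment (inj₂ g≼y) = g≼y

  entryFn-valid : Valid 1 entryFn
  entryFn-valid = monotonic , complete , λ _ _ _ _ → tt
    where
    monotonic : Mono 0 entryFn
    monotonic x y n v y≼x e = v , firstEntry-mono 0 y x n y≼x e , refl

    complete : Complete 0 entryFn
    complete P path n with path-long 0 path n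
    ... | y , Py , n<y = y , Py , firstEntry-defined 0 y n n<y

module Counterexample (em : ExcludedMiddle 0ℓ) (t : ℕ) where
  open Classical em

  0<s : 0 < suc t
  0<s = s≤s z≤n

  0≤t : 0 ≤ t
  0≤t = k<s⇒k≤pred 0<s

  Γ : Ctx (suc t)
  Γ = gen 0 0<s ∷ []

  ρ : Env (suc t) Γ
  ρ = (entryFn , entryFn-valid) ∷ₑ []ₑ

  isOne : Fm (suc t) true (num ∷ Γ)
  isOne = eq0 (Ap 0<s (var (there here)) (var here)) (S zer)

  OneAt : D t → ℕ → Set
  OneAt β c = firstEntry t β c ≡ just 1

  Forced : D t → ℕ → Set
  Forced β c = Forces (suc t) β (c ∷ₑ ρ) isOne

  AtomTrue : D t → ℕ → Set
  AtomTrue β c = ValEq _≡_ (eval β (c ∷ₑ ρ) (Ap 0<s (var (there here)) (var here))) (just 1)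

  AtomTrue⇒OneAt : ∀ β c → AtomTrue β c → OneAt β c
  AtomTrue⇒OneAt β c v =
    trans (sym (firstEntry-trunc t 0≤t β c)) (ValEq-just (entryFn (trunc 0≤t β) c) v)
    where
    ValEq-just : ∀ m → ValEq _≡_ m (just 1) → m ≡ just 1
    ValEq-just (just _) refl = refl

  OneAt⇒AtomTrue : ∀ β c → OneAt β c → AtomTrue β c
  OneAt⇒AtomTrue β c e =
    subst (λ m → ValEq _≡_ m (just 1)) (sym (trans (firstEntry-trunc t 0≤t β c) e)) refl

  OneAt⇒Forced : ∀ β c → OneAt β c → Forced β c
  OneAt⇒Forced β c e _ (_ , Pβ) = β , Pβ , OneAt⇒AtomTrue β c e

  Forced⇒OneAt-on-ray : ∀ γ β c → ray t γ β ≡ true → Forced β c →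
    Σ ℕ λ n → OneAt (pad t n γ) c
  Forced⇒OneAt-on-ray γ β c on-rayβ forced with forced (ray t γ) (ray-isPath t γ , on-rayβ)
  ... | δ , on-rayδ , v = lh δ , firstEntry-mono t _ δ c (on-ray t on-rayδ) (AtomTrue⇒OneAt δ c v)

  Forced-below : ∀ γ β c {v} → Le t γ β → firstEntry t β c ≡ just v → Forced γ c → v ≡ 1
  Forced-below γ β c {v} γ≼β e forced with Forced⇒OneAt-on-ray γ γ c (ray-start t γ) forced
  ... | n , one = just-injective (trans (sym below) one)
    where
    just-injective : ∀ {a b : ℕ} → just a ≡ just b → a ≡ b
    just-injective refl = refl
    below : firstEntry t (pad t n γ) c ≡ just v
    below = firstEntry-mono t (pad t n γ) β c (Le-trans t _ γ β (Le-pad t γ {0} {n} z≤n) γ≼β) e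

  decided : BForces (suc t) ρ (all num (or isOne (neg isOne)))
  decided c P (path , _) with path-long t path c
  ... | β , Pβ , c<β with firstEntry-defined t β c c<β
  ... | v , e with v ≟ 1
  ... | yes refl = β , Pβ , inj₁ (OneAt⇒Forced β c e)
  ... | no v≢1   = β , Pβ , inj₂ λ γ γ≼β forced → v≢1 (Forced-below γ β c γ≼β e forced)

  ¬¬witnessed : BForces (suc t) ρ (neg (neg (ex num isOne)))
  ¬¬witnessed β _ none = none β′ (Le-extend t 1 β) λ _ (_ , Pβ′) →
    β′ , Pβ′ , lh β , OneAt⇒Forced β′ (lh β) (firstEntry-extend t 1 β)
    where
    β′ : D t
    β′ = extend t 1 β

  unwitnessed : ¬ BForces (suc t) ρ (ex num isOne)
  unwitnessed witnessed with witnessed (ray t (root t)) (ray-isPath t (root t) , ray-start t (root t))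
  ... | β , on-rayβ , c , forced with Forced⇒OneAt-on-ray (root t) β c on-rayβ forced
  ... | n , one with firstEntry-pad t n (root t) c one
  ... | inj₁ e = firstEntry-root t c e
  ... | inj₂ ()

  markov-fails : ¬ BForces (suc t) ρ (MarkovInstance isOne)
  markov-fails markov = unwitnessed (markov (root t) (Le-refl t (root t)) (decided , ¬¬witnessed))

theorem11p3 : ExcludedMiddle 0ℓ → (s : ℕ) → 1 ≤ s →
    (Σ (Ctx s) (λ Γ → Σ (Fm s true (num ∷ Γ)) (λ φ → Σ (Env s Γ) (λ ρ →
        BForces s ρ (all num (or φ (neg φ)))
      × BForces s ρ (neg (neg (ex num φ)))
      × ¬ BForces s ρ (ex num φ)))))
    × (Σ (Ctx s) (λ Γ → Σ (Fm s true (num ∷ Γ)) (λ φ → Σ (Env s Γ) (λ ρ →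
        ¬ BForces s ρ (MarkovInstance φ)))))
theorem11p3 em (suc t) _ =
  (Γ , isOne , ρ , decided , ¬¬witnessed , unwitnessed) , (Γ , isOne , ρ , markov-fails)
  where open Counterexample em t
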